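{- If $\Gamma$ is a finite, simple, strongly connected, vertex-transitive digraph with $\dim(\Gamma)=1$, then $\Gamma$ is weakly distance-transitive.
   Context: $\partial(x,y)$ is the length of a shortest directed path from $x$ to $y$, $\tilde\partial(x,y)=(\partial(x,y),\partial(y,x))$. A vertex set $\{w_1,\dots,w_m\}$ is weakly resolving if $(\tilde\partial(w_1,u),\dots,\tilde\partial(w_m,u))\neq(\tilde\partial(w_1,v),\dots,\tilde\partial(w_m,v))$ for all distinct $u,v$; $\dim$ is the minimum size of such a set. $\Gamma$ is vertex-transitive if its automorphism group acts transitively on vertices. $\Gamma$ is weakly distance-transitive if for all vertices $x,y,x',y'$ with $\tilde\partial(x,y)=\tilde\partial(x',y')$ there is an automorphism $\sigma$ of $\Gamma$ with $\sigma(x)=x'$ and $\sigma(y)=y'$. -}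

module Defs where

open import Data.Nat using (ℕ; zero; suc; _≤_)
open import Data.Fin using (Fin)
open import Data.Bool using (Bool; T)
open import Data.List using (List; length)
open import Data.List.Membership.Propositional using (_∈_)
open import Data.Product using (Σ; ∃; _×_)
open import Relation.Nullary using (¬_)
open import Relation.Binary.PropositionalEquality using (_≡_)
open import Function.Bundles using (_↔_; Inverse)

-- A finite digraph on vertex set Fin n, given by its arc relation
-- (a Bool-valued adjacency, so at most one arc x → y: no multi-arcs).
Digraph : ℕ → Set
Digraph n = Fin n → Fin n → Bool

module _ {n : ℕ} (Γ : Digraph n) where

  -- Simple: no loops (multiple arcs are excluded by the representation).
  Simple : Set
  Simple = ∀ x → ¬ T (Γ x x)

  data Walk : Fin n → Fin n → ℕ → Set where
    here : ∀ {x} → Walk x x zero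
    step : ∀ {x y z k} → T (Γ x y) → Walk y z k → Walk x z (suc k)

  StronglyConnected : Set
  StronglyConnected = ∀ x y → ∃ λ k → Walk x y k

  IsDist : Fin n → Fin n → ℕ → Set
  IsDist x y d = Walk x y d × (∀ k → Walk x y k → d ≤ k)

  IsAutomorphism : (Fin n ↔ Fin n) → Set
  IsAutomorphism σ = ∀ x y → Γ x y ≡ Γ (Inverse.to σ x) (Inverse.to σ y)

  VertexTransitive : Set
  VertexTransitive = ∀ x y → Σ (Fin n ↔ Fin n) λ σ →
    IsAutomorphism σ × Inverse.to σ x ≡ y

  SameBiDist : Fin n → Fin n → Fin n → Set
  SameBiDist w u v =
    (∀ a b → IsDist w u a → IsDist w v b → a ≡ b) ×
    (∀ a b → IsDist u w a → IsDist v w b → a ≡ b)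

  WeaklyResolving : List (Fin n) → Set
  WeaklyResolving W = ∀ u v → (∀ w → w ∈ W → SameBiDist w u v) → u ≡ v

  HasDim : ℕ → Set
  HasDim m =
    (Σ (List (Fin n)) λ W → WeaklyResolving W × length W ≡ m) ×
    (∀ W → WeaklyResolving W → m ≤ length W)

  WeaklyDistanceTransitive : Set
  WeaklyDistanceTransitive = ∀ x y x′ y′ a b →
    IsDist x y a → IsDist y x b → IsDist x′ y′ a → IsDist y′ x′ b →
    Σ (Fin n ↔ Fin n) λ σ →
      IsAutomorphism σ × Inverse.to σ x ≡ x′ × Inverse.to σ y ≡ y′

-- A single vertex w resolves Γ, and an automorphism carries
-- resolving vertices to resolving vertices, so by vertex-transitivity every
-- vertex resolves Γ. Given x, y, x′, y′ with ∂̃(x,y) = ∂̃(x′,y′), take an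
-- automorphism σ with σ x = x′; then σ y and y′ have the same ∂̃ from x′,
-- and since x′ resolves Γ, σ y = y′.
module Submission where

open import Defs
open import Data.Nat using (ℕ)
open import Data.Nat.Properties using (≤-antisym)
open import Data.Fin using (Fin)
open import Data.Bool using (T)
open import Data.List using ([]; _∷_)
open import Data.List.Relation.Unary.Any using (here)
open import Data.Product using (∃; _,_)
open import Relation.Binary.PropositionalEquality
  using (_≡_; refl; sym; trans; cong₂; subst; subst₂)
open import Function.Bundles using (_↔_; Inverse; Injection)
open import Function.Properties.Inverse using (↔⇒↣)

module _ {n : ℕ} (Γ : Digraph n) where

  ResolvingVertex : Fin n → Set
  ResolvingVertex w = ∀ u v → SameBiDist Γ w u v → u ≡ v

  IsDist-unique : ∀ {x y d e} → IsDist Γ x y d → IsDist Γ x y e → d ≡ e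
  IsDist-unique (p , p-min) (q , q-min) = ≤-antisym (p-min _ q) (q-min _ p)

  sameBiDist : ∀ {w u v a b} →
    IsDist Γ w u a → IsDist Γ u w b → IsDist Γ w v a → IsDist Γ v w b →
    SameBiDist Γ w u v
  sameBiDist wu uw wv vw =
    (λ _ _ wu′ wv′ → trans (IsDist-unique wu′ wu) (IsDist-unique wv wv′)) ,
    (λ _ _ uw′ vw′ → trans (IsDist-unique uw′ uw) (IsDist-unique vw vw′))

  WeaklyResolving-singleton : ∀ {w} → WeaklyResolving Γ (w ∷ []) → ResolvingVertex w
  WeaklyResolving-singleton res u v same = res u v λ { _ (here refl) → same }

  HasDim-1⇒resolvingVertex : HasDim Γ 1 → ∃ ResolvingVertex
  HasDim-1⇒resolvingVertex ((w ∷ [] , res , refl) , _) = w , WeaklyResolving-singleton res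

module _ {n : ℕ} (Γ : Digraph n) (σ : Fin n ↔ Fin n) (aut : IsAutomorphism Γ σ) where
  open Inverse σ

  Walk-map : ∀ {x y k} → Walk Γ x y k → Walk Γ (to x) (to y) k
  Walk-map here = here
  Walk-map (step {x} {y} e p) = step (subst T (aut x y) e) (Walk-map p)

  Walk-pullback : ∀ {x y k} → Walk Γ x y k → Walk Γ (from x) (from y) k
  Walk-pullback here = here
  Walk-pullback (step {x} {y} e p) = step (subst T arc≡ e) (Walk-pullback p)
    where
    arc≡ : Γ x y ≡ Γ (from x) (from y)
    arc≡ = sym (trans (aut (from x) (from y))
                      (cong₂ Γ (strictlyInverseˡ x) (strictlyInverseˡ y)))

  Walk-reflect : ∀ {x y k} → Walk Γ (to x) (to y) k → Walk Γ x y k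
  Walk-reflect {x} {y} p =
    subst₂ (λ x′ y′ → Walk Γ x′ y′ _) (strictlyInverseʳ x) (strictlyInverseʳ y)
           (Walk-pullback p)

  IsDist-map : ∀ {x y d} → IsDist Γ x y d → IsDist Γ (to x) (to y) d
  IsDist-map (p , p-min) = Walk-map p , λ k q → p-min k (Walk-reflect q)

  IsDist-reflect : ∀ {x y d} → IsDist Γ (to x) (to y) d → IsDist Γ x y d
  IsDist-reflect (p , p-min) = Walk-reflect p , λ k q → p-min k (Walk-map q)

  SameBiDist-map : ∀ {w u v} → SameBiDist Γ w u v → SameBiDist Γ (to w) (to u) (to v)
  SameBiDist-map (outward , inward) =
    (λ a b wu wv → outward a b (IsDist-reflect wu) (IsDist-reflect wv)) ,
    (λ a b uw vw → inward a b (IsDist-reflect uw) (IsDist-reflect vw))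

  resolvingVertex-reflect : ∀ {w} → ResolvingVertex Γ (to w) → ResolvingVertex Γ w
  resolvingVertex-reflect res u v same =
    Injection.injective (↔⇒↣ σ) (res (to u) (to v) (SameBiDist-map same))

  biDist-determines-image : ∀ {x y x′ y′ a b} → ResolvingVertex Γ x′ → to x ≡ x′ →
    IsDist Γ x y a → IsDist Γ y x b → IsDist Γ x′ y′ a → IsDist Γ y′ x′ b →
    to y ≡ y′
  biDist-determines-image {y = y} res refl xy yx x′y′ y′x′ =
    res (to y) _ (sameBiDist Γ (IsDist-map xy) (IsDist-map yx) x′y′ y′x′)

vertexTransitive-resolvingVertex : ∀ {n} (Γ : Digraph n) → VertexTransitive Γ →
  ∀ {w} → ResolvingVertex Γ w → ∀ z → ResolvingVertex Γ z
vertexTransitive-resolvingVertex Γ vt {w} res z with vt z w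
... | σ , aut , refl = resolvingVertex-reflect Γ σ aut res

lemma3p7 : (n : ℕ) (Γ : Digraph n) →
    Simple Γ → StronglyConnected Γ → VertexTransitive Γ → HasDim Γ 1 →
    WeaklyDistanceTransitive Γ
lemma3p7 n Γ _ _ vt dim1 x y x′ y′ a b xy yx x′y′ y′x′
  with HasDim-1⇒resolvingVertex Γ dim1 | vt x x′
... | _ , res | σ , aut , σx≡x′ =
  σ , aut , σx≡x′ ,
  biDist-determines-image Γ σ aut (vertexTransitive-resolvingVertex Γ vt res x′)
                        σx≡x′ xy yx x′y′ y′x′
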